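{- Let $r\geqslant 2$ and $\ell\geqslant 1$ be integers, and set $m=2^r(2^{\ell}+1)$ and $d=(m-2)/2$. (i) If $\gcd(r,\ell)=1$ then $\gcd(d,2^{2\ell}-1)=1$. (ii) If $\gcd(r,\ell)=2$ then $\gcd(d,2^{2\ell}-1)=3$. -}

module Defs where

open import Data.Nat using (ℕ; _+_; _*_; _∸_; _^_; _/_)

m : ℕ → ℕ → ℕ
m r ℓ = 2 ^ r * (2 ^ ℓ + 1)

-- d = (m - 2) / 2   (m is even and ≥ 2 for r ≥ 2, so this is exact)
d : ℕ → ℕ → ℕ
d r ℓ = (m r ℓ ∸ 2) / 2

-- Put M n = 2 ^ n - 1. Since d + 1 = 2^(r-1) (2^ℓ + 1), a common divisor e of d and
-- M (2ℓ) = (2^ℓ + 1) M ℓ is coprime to 2^ℓ + 1, hence divides M ℓ, and then also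
-- M r = d - 2^(r-1) M ℓ. As gcd (M r) (M ℓ) divides M (gcd r ℓ), e divides M 1 = 1 or
-- M 2 = 3; in the second case 3 = M 2 divides M r, M ℓ and hence d and M (2ℓ).
module Submission where

open import Defs
open import Data.Nat using (ℕ; zero; suc; _+_; _*_; _∸_; _^_; _/_; _≤_; NonZero; pred)
open import Data.Nat.Properties
open import Data.Nat.Divisibility
open import Data.Nat.DivMod using (m*n/n≡m)
open import Data.Nat.GCD using (gcd; gcd[m,n]∣m; gcd[m,n]∣n; gcd-greatest; gcd-GCD; module Bézout)
open import Data.Nat.Coprimality using (Coprime; coprime-divisor)
open import Data.Nat.Tactic.RingSolver using (solve-∀)
open import Data.Product using (_×_; _,_)
open import Relation.Binary.PropositionalEquality
  using (_≡_; refl; sym; trans; cong; subst; module ≡-Reasoning)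

open ≡-Reasoning

module _ (b : ℕ) .{{_ : NonZero b}} where

  suc[b^n∸1]≡b^n : ∀ n → suc (b ^ n ∸ 1) ≡ b ^ n
  suc[b^n∸1]≡b^n n = suc-pred (b ^ n) {{m^n≢0 b n}}

  b^[n+o]∸1≡b^n∸1+b^n*[b^o∸1] : ∀ n o → b ^ (n + o) ∸ 1 ≡ (b ^ n ∸ 1) + b ^ n * (b ^ o ∸ 1)
  b^[n+o]∸1≡b^n∸1+b^n*[b^o∸1] n o = suc-injective (begin
    suc (b ^ (n + o) ∸ 1)                 ≡⟨ suc[b^n∸1]≡b^n (n + o) ⟩
    b ^ (n + o)                           ≡⟨ ^-distribˡ-+-* b n o ⟩
    b ^ n * b ^ o                         ≡⟨ cong (b ^ n *_) (sym (suc[b^n∸1]≡b^n o)) ⟩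
    b ^ n * suc (b ^ o ∸ 1)               ≡⟨ *-suc (b ^ n) (b ^ o ∸ 1) ⟩
    b ^ n + b ^ n * (b ^ o ∸ 1)           ≡⟨ cong (_+ b ^ n * (b ^ o ∸ 1)) (sym (suc[b^n∸1]≡b^n n)) ⟩
    suc (b ^ n ∸ 1) + b ^ n * (b ^ o ∸ 1) ∎)

  b^[2*n]∸1≡suc[b^n]*[b^n∸1] : ∀ n → b ^ (2 * n) ∸ 1 ≡ suc (b ^ n) * (b ^ n ∸ 1)
  b^[2*n]∸1≡suc[b^n]*[b^n∸1] n = begin
    b ^ (n + (n + 0)) ∸ 1                 ≡⟨ cong (λ k → b ^ (n + k) ∸ 1) (+-identityʳ n) ⟩
    b ^ (n + n) ∸ 1                       ≡⟨ b^[n+o]∸1≡b^n∸1+b^n*[b^o∸1] n n ⟩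
    (b ^ n ∸ 1) + b ^ n * (b ^ n ∸ 1)     ∎

  b^n∸1∣b^[k*n]∸1 : ∀ k n → b ^ n ∸ 1 ∣ b ^ (k * n) ∸ 1
  b^n∸1∣b^[k*n]∸1 zero    n = _ ∣0
  b^n∸1∣b^[k*n]∸1 (suc k) n = subst (b ^ n ∸ 1 ∣_) (sym (b^[n+o]∸1≡b^n∸1+b^n*[b^o∸1] n (k * n)))
    (∣m∣n⇒∣m+n ∣-refl (∣n⇒∣m*n (b ^ n) (b^n∸1∣b^[k*n]∸1 k n)))

  ∣⇒b^n∸1∣b^o∸1 : ∀ {n o} → n ∣ o → b ^ n ∸ 1 ∣ b ^ o ∸ 1
  ∣⇒b^n∸1∣b^o∸1 {n} (divides k refl) = b^n∸1∣b^[k*n]∸1 k n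

  ∣b^[n+o]∸1∧∣b^o∸1⇒∣b^n∸1 : ∀ {e} n o → e ∣ b ^ (n + o) ∸ 1 → e ∣ b ^ o ∸ 1 → e ∣ b ^ n ∸ 1
  ∣b^[n+o]∸1∧∣b^o∸1⇒∣b^n∸1 {e} n o e∣n+o e∣o = ∣m+n∣m⇒∣n
    (subst (e ∣_) (trans (b^[n+o]∸1≡b^n∸1+b^n*[b^o∸1] n o) (+-comm (b ^ n ∸ 1) _)) e∣n+o)
    (∣n⇒∣m*n (b ^ n) e∣o)

  -- Bézout gives g + y·o = x·n (or the same with n and o swapped); both multiples are
  -- divisible by e, and subtracting recovers b ^ g ∸ 1.
  ∣b^n∸1∧∣b^o∸1⇒∣b^gcd[n,o]∸1 : ∀ {e} n o → e ∣ b ^ n ∸ 1 → e ∣ b ^ o ∸ 1 → e ∣ b ^ gcd n o ∸ 1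
  ∣b^n∸1∧∣b^o∸1⇒∣b^gcd[n,o]∸1 {e} n o e∣n e∣o with Bézout.identity (gcd-GCD n o)
  ... | Bézout.+- x y eq = ∣b^[n+o]∸1∧∣b^o∸1⇒∣b^n∸1 (gcd n o) (y * o)
          (subst (λ k → e ∣ b ^ k ∸ 1) (sym eq) (∣-trans e∣n (b^n∸1∣b^[k*n]∸1 x n)))
          (∣-trans e∣o (b^n∸1∣b^[k*n]∸1 y o))
  ... | Bézout.-+ x y eq = ∣b^[n+o]∸1∧∣b^o∸1⇒∣b^n∸1 (gcd n o) (x * n)
          (subst (λ k → e ∣ b ^ k ∸ 1) (sym eq) (∣-trans e∣o (b^n∸1∣b^[k*n]∸1 y o)))
          (∣-trans e∣n (b^n∸1∣b^[k*n]∸1 x n))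

suc[d[1+r,ℓ]]≡2^r*suc[2^ℓ] : ∀ r ℓ → suc (d (suc r) ℓ) ≡ 2 ^ r * suc (2 ^ ℓ)
suc[d[1+r,ℓ]]≡2^r*suc[2^ℓ] r ℓ = begin
  suc ((2 * 2 ^ r * (2 ^ ℓ + 1) ∸ 2) / 2)   ≡⟨ cong (λ k → suc ((k ∸ 2) / 2)) (*-assoc 2 (2 ^ r) _) ⟩
  suc ((2 * (2 ^ r * (2 ^ ℓ + 1)) ∸ 2) / 2) ≡⟨ cong (λ k → suc ((2 * (2 ^ r * k) ∸ 2) / 2)) (+-comm (2 ^ ℓ) 1) ⟩
  suc ((2 * X ∸ 2) / 2)                     ≡⟨ cong (λ k → suc (k / 2)) (sym (*-distribˡ-∸ 2 X 1)) ⟩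
  suc ((2 * pred X) / 2)                    ≡⟨ cong (λ k → suc (k / 2)) (*-comm 2 (pred X)) ⟩
  suc ((pred X * 2) / 2)                    ≡⟨ cong suc (m*n/n≡m (pred X) 2) ⟩
  suc (pred X)                              ≡⟨ suc-pred X {{m*n≢0 (2 ^ r) _ {{m^n≢0 2 r}}}} ⟩
  X                                         ∎
  where X = 2 ^ r * suc (2 ^ ℓ)

d[1+r,ℓ]≡2^r*[2^ℓ∸1]+[2^[1+r]∸1] : ∀ r ℓ → d (suc r) ℓ ≡ 2 ^ r * (2 ^ ℓ ∸ 1) + (2 ^ suc r ∸ 1)
d[1+r,ℓ]≡2^r*[2^ℓ∸1]+[2^[1+r]∸1] r ℓ = suc-injective (begin
  suc (d (suc r) ℓ)                         ≡⟨ suc[d[1+r,ℓ]]≡2^r*suc[2^ℓ] r ℓ ⟩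
  2 ^ r * suc (2 ^ ℓ)                       ≡⟨ cong (λ k → 2 ^ r * suc k) (sym (suc[b^n∸1]≡b^n 2 ℓ)) ⟩
  2 ^ r * suc (suc (2 ^ ℓ ∸ 1))             ≡⟨ split (2 ^ r) (2 ^ ℓ ∸ 1) ⟩
  2 ^ r * (2 ^ ℓ ∸ 1) + 2 ^ suc r           ≡⟨ cong (2 ^ r * (2 ^ ℓ ∸ 1) +_) (sym (suc[b^n∸1]≡b^n 2 (suc r))) ⟩
  2 ^ r * (2 ^ ℓ ∸ 1) + suc (2 ^ suc r ∸ 1) ≡⟨ +-suc _ _ ⟩
  suc (2 ^ r * (2 ^ ℓ ∸ 1) + (2 ^ suc r ∸ 1)) ∎)
  where
  split : ∀ a b → a * suc (suc b) ≡ a * b + 2 * a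
  split = solve-∀

∣d∧∣2^[2ℓ]∸1⇒∣2^gcd∸1 : ∀ {e} r ℓ → e ∣ d (suc r) ℓ → e ∣ 2 ^ (2 * ℓ) ∸ 1 → e ∣ 2 ^ gcd (suc r) ℓ ∸ 1
∣d∧∣2^[2ℓ]∸1⇒∣2^gcd∸1 {e} r ℓ e∣d e∣N = ∣b^n∸1∧∣b^o∸1⇒∣b^gcd[n,o]∸1 2 (suc r) ℓ e∣2^[1+r]∸1 e∣2^ℓ∸1
  where
  coprime : Coprime e (suc (2 ^ ℓ))
  coprime {f} (f∣e , f∣2^ℓ+1) = ∣1⇒≡1 (∣m+n∣m⇒∣n
    (subst (f ∣_) (sym (trans (+-comm (d (suc r) ℓ) 1) (suc[d[1+r,ℓ]]≡2^r*suc[2^ℓ] r ℓ))) (∣n⇒∣m*n (2 ^ r) f∣2^ℓ+1))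
    (∣-trans f∣e e∣d))
  e∣2^ℓ∸1 : e ∣ 2 ^ ℓ ∸ 1
  e∣2^ℓ∸1 = coprime-divisor coprime (subst (e ∣_) (b^[2*n]∸1≡suc[b^n]*[b^n∸1] 2 ℓ) e∣N)
  e∣2^[1+r]∸1 : e ∣ 2 ^ suc r ∸ 1
  e∣2^[1+r]∸1 = ∣m+n∣m⇒∣n (subst (e ∣_) (d[1+r,ℓ]≡2^r*[2^ℓ∸1]+[2^[1+r]∸1] r ℓ) e∣d)
    (∣n⇒∣m*n (2 ^ r) e∣2^ℓ∸1)

lemma3p2 : (r ℓ : ℕ) → 2 ≤ r → 1 ≤ ℓ →
    (gcd r ℓ ≡ 1 → gcd (d r ℓ) (2 ^ (2 * ℓ) ∸ 1) ≡ 1) ×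
    (gcd r ℓ ≡ 2 → gcd (d r ℓ) (2 ^ (2 * ℓ) ∸ 1) ≡ 3)
lemma3p2 (suc r) ℓ _ _ = coprime-case , three-case
  where
  N g : ℕ
  N = 2 ^ (2 * ℓ) ∸ 1
  g = gcd (d (suc r) ℓ) N
  g∣2^gcd∸1 : g ∣ 2 ^ gcd (suc r) ℓ ∸ 1
  g∣2^gcd∸1 = ∣d∧∣2^[2ℓ]∸1⇒∣2^gcd∸1 r ℓ (gcd[m,n]∣m (d (suc r) ℓ) N) (gcd[m,n]∣n (d (suc r) ℓ) N)

  coprime-case : gcd (suc r) ℓ ≡ 1 → g ≡ 1
  coprime-case eq = ∣1⇒≡1 (subst (λ k → g ∣ 2 ^ k ∸ 1) eq g∣2^gcd∸1)

  three-case : gcd (suc r) ℓ ≡ 2 → g ≡ 3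
  three-case eq = ∣-antisym (subst (λ k → g ∣ 2 ^ k ∸ 1) eq g∣2^gcd∸1) (gcd-greatest 3∣d 3∣N)
    where
    3∣2^[1+r]∸1 : 3 ∣ 2 ^ suc r ∸ 1
    3∣2^[1+r]∸1 = ∣⇒b^n∸1∣b^o∸1 2 (subst (_∣ suc r) eq (gcd[m,n]∣m (suc r) ℓ))
    3∣2^ℓ∸1 : 3 ∣ 2 ^ ℓ ∸ 1
    3∣2^ℓ∸1 = ∣⇒b^n∸1∣b^o∸1 2 (subst (_∣ ℓ) eq (gcd[m,n]∣n (suc r) ℓ))
    3∣d : 3 ∣ d (suc r) ℓ
    3∣d = subst (3 ∣_) (sym (d[1+r,ℓ]≡2^r*[2^ℓ∸1]+[2^[1+r]∸1] r ℓ))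
      (∣m∣n⇒∣m+n (∣n⇒∣m*n (2 ^ r) 3∣2^ℓ∸1) 3∣2^[1+r]∸1)
    3∣N : 3 ∣ N
    3∣N = ∣⇒b^n∸1∣b^o∸1 2 (divides ℓ (*-comm 2 ℓ))
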